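{- For every $n \ge 3$, the parity game $G_n$ (defined in the context), together with the initial strategy $\theta$, is a binary sink parity game with sink $t$.
   Context: A parity game is a tuple $G=(V,V_0,V_1,E,\Omega)$ where $(V,E)$ is a finite directed graph in which every node has at least one successor, $V=V_0\cup V_1$ is a partition (nodes of player 0 and player 1), and $\Omega:V\to\mathbb{N}$ is a priority function. Write $vE=\{w:(v,w)\in E\}$. A positional strategy for player $i$ is a map $\sigma:V_i\to V$ with $\sigma(v)\in vE$. A parity game is binary if every node of $V_0$ has exactly two successors. Valuations. For positional strategies $\sigma$ (player 0) and $\tau$ (player 1) and a node $v$, the unique play from $v$ conforming to both can be written $v_1\ldots v_k(w_1\ldots w_l)^\omega$ with all listed nodes pairwise distinct and $w_1$ the node of maximal priority on the cycle $w_1\ldots w_l$ (in the games below this maximum is attained at a unique node of each cycle). Its valuation is $\vartheta_{\sigma,\tau,v}=(w_1,\{v_i:1\le i\le k,\ \Omega(v_i)>\Omega(w_1)\},k)$. Let $rew(u)=\Omega(u)$ if $\Omega(u)$ is even and $rew(u)=-\Omega(u)$ otherwise. For finite node sets $M,N$ let $\Omega(M)(p)=|\{u\in M:\Omega(u)=p\}|$; write $M\sim N$ if $\Omega(M)=\Omega(N)$; otherwise, with $p$ the largest priority where $\Omega(M)(p)\ne\Omega(N)(p)$, set $M\prec N$ iff ($p$ odd and $\Omega(M)(p)>\Omega(N)(p)$) or ($p$ even and $\Omega(M)(p)<\Omega(N)(p)$), and $N\prec M$ otherwise. Then $(u,M,e)\prec(v,N,f)$ iff $rew(u)<rew(v)$,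 or $rew(u)=rew(v)$ and one of: $M\prec N$; $M\sim N$, $e<f$ and $\Omega(u)$ odd; $M\sim N$, $e>f$ and $\Omega(u)$ even. Write $x\preceq y$ if $x\prec y$ or neither $x\prec y$ nor $y\prec x$. An optimal counter-strategy $\tau_\sigma$ to $\sigma$ is a player-1 positional strategy with $\vartheta_{\sigma,\tau_\sigma,v}\preceq\vartheta_{\sigma,\tau',v}$ for all player-1 positional strategies $\tau'$ and all nodes $v$ (one always exists); fix one and put $\Xi_\sigma(v)=\vartheta_{\sigma,\tau_\sigma,v}$. For valuations-maps, $\Xi\unlhd\Xi'$ means $\Xi(v)\preceq\Xi'(v)$ for all $v$. Sink games. A parity game $G$ with an initial player-0 strategy $\theta$ is a sink game with sink $v^*$ iff (1) $(v^*,v^*)\in E$, $\Omega(v^*)=1$, $v^*$ is reachable from every node, and no other node $w$ has $\Omega(w)\le\Omega(v^*)$; and (2) for every player-0 positional strategy $\sigma$ with $\Xi_\theta\unlhd\Xi_\sigma$ and every node $w$, the first component of $\Xi_\sigma(w)$ equals $v^*$. The game $G_n$ ($n\ge3$). $V_0=\{a_i,c_i,d_i:1<i\le n\}\cup\{b_i:1<i<n\}\cup\{e_i:1\le i\le n\}$ and $V_1=\{F_i,g_i,h_i:1\le i\le n\}\cup\{s,t\}$. With the identifications $a_{n+1}=t$, $b_1=g_1$, $c_1=g_1$, the edges and priorities are: $a_i\to g_i,a_{i+1}$ (priority 3); $b_i\to g_i,b_{i-1}$ (priority 3); $c_i\to g_i,c_{i-1}$ (priority 3); $d_i\to F_i,b_{i-1}$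 (priority 5); $e_i\to F_i,s$ (priority 5); $F_i\to h_i,e_i$ and additionally $F_i\to d_i$ if $i>1$ (priority 6); $g_i\to F_i$ (priority $2i+7$); $h_i\to a_{i+1}$ (priority $2i+8$); $s\to c_n$ (priority 8); $t\to t$ (priority 1). Name the player-0 edges $x_i^1=(x_i,g_i)$ for $x\in\{a,b,c\}$, $a_i^0=(a_i,a_{i+1})$, $b_i^0=(b_i,b_{i-1})$, $c_i^0=(c_i,c_{i-1})$, $d_i^1=(d_i,F_i)$, $d_i^0=(d_i,b_{i-1})$, $e_i^1=(e_i,F_i)$, $e_i^0=(e_i,s)$. The initial strategy $\theta$ uses the edges $a_i^0,b_i^0,c_i^0,d_i^1$ for all relevant $i$, $e_1^1$, and $e_i^0$ for $i>1$. -}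

module Defs where

open import Data.Nat using (ℕ; zero; suc; _+_; _*_; _≤_; _<_; _≤ᵇ_; _≡ᵇ_; _%_; pred)
import Data.Nat as ℕ
open import Data.Integer as ℤ using (ℤ; +_; -_)
open import Data.Bool using (Bool; true; false; T; _∧_; if_then_else_)
open import Data.Unit using (⊤; tt)
open import Data.Empty using (⊥)
open import Data.Product using (Σ; Σ-syntax; ∃; ∃-syntax; _×_; _,_; proj₁; proj₂)
open import Data.Sum using (_⊎_)
open import Data.List using (List; []; _∷_; length; filter; map; upTo)
open import Data.List.Membership.Propositional using (_∈_)
open import Relation.Nullary using (¬_)
open import Relation.Binary.PropositionalEquality using (_≡_; _≢_)
open import Relation.Binary.Construct.Closure.ReflexiveTransitive using (Star)

data Player : Set where
  P0 P1 : Player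

record Game : Set₁ where
  field
    V     : Set
    owner : V → Player          -- v ∈ V_0  iff  owner v ≡ P0
    E     : V → V → Set
    Ω     : V → ℕ

module _ (G : Game) where
  open Game G

  IsParityGame : Set
  IsParityGame = (Σ[ xs ∈ List V ] (∀ v → v ∈ xs)) × (∀ v → Σ[ w ∈ V ] E v w)

  IsBinary : Set
  IsBinary = ∀ v → owner v ≡ P0 →
    Σ[ w₁ ∈ V ] Σ[ w₂ ∈ V ] (w₁ ≢ w₂ × E v w₁ × E v w₂ ×
      (∀ w → E v w → w ≡ w₁ ⊎ w ≡ w₂))

  -- positional strategy of player i (values at nodes not owned by i are irrelevant)
  Strategy : Player → Set
  Strategy i = Σ[ σ ∈ (V → V) ] (∀ v → owner v ≡ i → E v (σ v))

  pick : Player → V → V → V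
  pick P0 x y = x
  pick P1 x y = y

  next : Strategy P0 → Strategy P1 → V → V
  next σ τ v = pick (owner v) (proj₁ σ v) (proj₁ τ v)

  play : Strategy P0 → Strategy P1 → V → ℕ → V
  play σ τ v zero    = v
  play σ τ v (suc j) = next σ τ (play σ τ v j)

  record Valuation : Set where
    constructor ⟨_,_,_⟩
    field
      node  : V
      nodes : List V
      len   : ℕ

  -- The play is π = v₁…v_k (w₁…w_l)^ω with π j = v_{j+1} (j < k), π (k + j) = w_{j+1};
  -- the v's pairwise distinct, the w's pairwise distinct, w₁ not among the v's,
  -- and w₁ of maximal priority on the cycle.
  IsVal : Strategy P0 → Strategy P1 → V → Valuation → Set
  IsVal σ τ v ⟨ w , M , e ⟩ =
    Σ[ k ∈ ℕ ] Σ[ l ∈ ℕ ]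
      ( 1 ≤ l
      × (∀ i j → i < j → j < k → π i ≢ π j)
      × (∀ i j → i < j → j < l → π (k + i) ≢ π (k + j))
      × (∀ i → i < k → π i ≢ π k)
      × π (k + l) ≡ π k
      × (∀ j → j < l → Ω (π (k + j)) ≤ Ω (π k))
      × w ≡ π k
      × M ≡ filter (λ u → Ω w ℕ.<? Ω u) (map π (upTo k))
      × e ≡ k )
    where π = play σ τ v

  rew : ℕ → ℤ
  rew p = if p % 2 ≡ᵇ 0 then + p else - (+ p)

  Odd Even : ℕ → Set
  Odd p = p % 2 ≡ 1
  Even p = p % 2 ≡ 0

  cnt : List V → ℕ → ℕ
  cnt M p = length (filter (λ u → Ω u ℕ.≟ p) M)

  _∼ₛ_ : List V → List V → Set
  M ∼ₛ N = ∀ p → cnt M p ≡ cnt N p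

  _≺ₛ_ : List V → List V → Set
  M ≺ₛ N = Σ[ p ∈ ℕ ] ( cnt M p ≢ cnt N p
                      × (∀ q → p < q → cnt M q ≡ cnt N q)
                      × ((Odd p × cnt N p < cnt M p) ⊎ (Even p × cnt M p < cnt N p)) )

  _≺_ : Valuation → Valuation → Set
  ⟨ u , M , e ⟩ ≺ ⟨ v , N , f ⟩ =
    rew (Ω u) ℤ.< rew (Ω v)
    ⊎ (rew (Ω u) ≡ rew (Ω v) ×
        (M ≺ₛ N ⊎ (M ∼ₛ N × e < f × Odd (Ω u)) ⊎ (M ∼ₛ N × f < e × Even (Ω u))))

  _⪯_ : Valuation → Valuation → Set
  x ⪯ y = x ≺ y ⊎ (¬ (x ≺ y) × ¬ (y ≺ x))

  IsOptimalCounter : Strategy P0 → Strategy P1 → Set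
  IsOptimalCounter σ τ = ∀ (τ' : Strategy P1) v x y → IsVal σ τ v x → IsVal σ τ' v y → x ⪯ y

  -- Ξ_σ ⊴ Ξ_σ' where Ξ_σ is given by the counter-strategy τ, Ξ_σ' by τ'
  _,_⊴_,_ : Strategy P0 → Strategy P1 → Strategy P0 → Strategy P1 → Set
  σ , τ ⊴ σ' , τ' = ∀ v x y → IsVal σ τ v x → IsVal σ' τ' v y → x ⪯ y

  IsSinkGame : Strategy P0 → V → Set
  IsSinkGame θ v* =
    ( E v* v* × Ω v* ≡ 1 × (∀ v → Star E v v*) × (∀ w → w ≢ v* → Ω v* < Ω w) )
    × (∀ (σ : Strategy P0) (τθ τσ : Strategy P1) →
         IsOptimalCounter θ τθ → IsOptimalCounter σ τσ →
         θ , τθ ⊴ σ , τσ →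
         ∀ w x → IsVal σ τσ w x → Valuation.node x ≡ v*)

data Kind : Set where
  kA kB kC kD kE kF kG kH kS kT : Kind

Raw : Set
Raw = Kind × ℕ

valid : ℕ → Raw → Bool
valid n (kA , i) = (2 ≤ᵇ i) ∧ (i ≤ᵇ n)
valid n (kB , i) = (2 ≤ᵇ i) ∧ (suc i ≤ᵇ n)
valid n (kC , i) = (2 ≤ᵇ i) ∧ (i ≤ᵇ n)
valid n (kD , i) = (2 ≤ᵇ i) ∧ (i ≤ᵇ n)
valid n (kE , i) = (1 ≤ᵇ i) ∧ (i ≤ᵇ n)
valid n (kF , i) = (1 ≤ᵇ i) ∧ (i ≤ᵇ n)
valid n (kG , i) = (1 ≤ᵇ i) ∧ (i ≤ᵇ n)
valid n (kH , i) = (1 ≤ᵇ i) ∧ (i ≤ᵇ n)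
valid n (kS , i) = i ≡ᵇ 0
valid n (kT , i) = i ≡ᵇ 0

Node : ℕ → Set
Node n = Σ Raw (λ r → T (valid n r))

-- identifications a_{n+1} = t, b_1 = g_1, c_1 = g_1
aN : ℕ → ℕ → Raw
aN n j = if j ≡ᵇ suc n then (kT , 0) else (kA , j)

bN cN : ℕ → Raw
bN j = if j ≡ᵇ 1 then (kG , 1) else (kB , j)
cN j = if j ≡ᵇ 1 then (kG , 1) else (kC , j)

data REdge (n : ℕ) : Raw → Raw → Set where
  a1 : ∀ i → REdge n (kA , i) (kG , i)
  a0 : ∀ i → REdge n (kA , i) (aN n (suc i))
  b1 : ∀ i → REdge n (kB , i) (kG , i)
  b0 : ∀ i → REdge n (kB , i) (bN (pred i))
  c1 : ∀ i → REdge n (kC , i) (kG , i)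
  c0 : ∀ i → REdge n (kC , i) (cN (pred i))
  d1 : ∀ i → REdge n (kD , i) (kF , i)
  d0 : ∀ i → REdge n (kD , i) (bN (pred i))
  e1 : ∀ i → REdge n (kE , i) (kF , i)
  e0 : ∀ i → REdge n (kE , i) (kS , 0)
  Fh : ∀ i → REdge n (kF , i) (kH , i)
  Fe : ∀ i → REdge n (kF , i) (kE , i)
  Fd : ∀ i → 1 < i → REdge n (kF , i) (kD , i)
  gF : ∀ i → REdge n (kG , i) (kF , i)
  hA : ∀ i → REdge n (kH , i) (aN n (suc i))
  sc : REdge n (kS , 0) (kC , n)
  tT : REdge n (kT , 0) (kT , 0)

ΩR : Raw → ℕ
ΩR (kA , i) = 3
ΩR (kB , i) = 3
ΩR (kC , i) = 3
ΩR (kD , i) = 5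
ΩR (kE , i) = 5
ΩR (kF , i) = 6
ΩR (kG , i) = 2 * i + 7
ΩR (kH , i) = 2 * i + 8
ΩR (kS , i) = 8
ΩR (kT , i) = 1

ownerR : Kind → Player
ownerR kA = P0
ownerR kB = P0
ownerR kC = P0
ownerR kD = P0
ownerR kE = P0
ownerR kF = P1
ownerR kG = P1
ownerR kH = P1
ownerR kS = P1
ownerR kT = P1

Gn : ℕ → Game
Gn n = record
  { V     = Node n
  ; owner = λ v → ownerR (proj₁ (proj₁ v))
  ; E     = λ v w → REdge n (proj₁ v) (proj₁ w)
  ; Ω     = λ v → ΩR (proj₁ v)
  }

tNode : (n : ℕ) → Node n
tNode n = (kT , 0) , tt

data ThetaEdge (n : ℕ) : Raw → Raw → Set where
  θa : ∀ i → ThetaEdge n (kA , i) (aN n (suc i))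
  θb : ∀ i → ThetaEdge n (kB , i) (bN (pred i))
  θc : ∀ i → ThetaEdge n (kC , i) (cN (pred i))
  θd : ∀ i → ThetaEdge n (kD , i) (kF , i)
  θe1 : ThetaEdge n (kE , 1) (kF , 1)
  θe0 : ∀ i → 1 < i → ThetaEdge n (kE , i) (kS , 0)

IsTheta : (n : ℕ) → Strategy (Gn n) P0 → Set
IsTheta n θ = ∀ v → Game.owner (Gn n) v ≡ P0 → ThetaEdge n (proj₁ v) (proj₁ (proj₁ θ v))

module Submission where

-- The proof rests on ranking functions.  If along the plays of fixed strategies
-- σ, τ every node either strictly decreases a rank μ : V → ℕ or closes a cycle
-- of length at most two on which it has maximal priority, then every play is a
-- descending prefix followed by such a cycle, which yields its valuation
-- (module Plays, general for all parity games).  In G_n two ranks do the work: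
-- ψ decreases along every play in which player 1 heads for t (τ-sink), so t is
-- reachable and every σ has valuations with cycle node t (reward -1) against
-- τ-sink; μ decreases along the plays of θ except on the loop at t and on
-- 2-cycles through some F_i (priority 6), so every valuation of θ has reward at
-- least -1.  If Ξ_θ ⊴ Ξ_σ, the reward of Ξ_σ(w) is therefore squeezed to -1,
-- i.e. its cycle node has priority 1, and t is the only such node.

open import Defs
open import Data.Nat using (ℕ; zero; suc; _+_; _*_; _∸_; _≤_; _<_; z≤n; s≤s; _≤ᵇ_; _≡ᵇ_; _%_)
import Data.Nat as ℕ
open import Data.Nat.Properties
open import Data.Integer as ℤ using (ℤ; -1ℤ; -≤+)
import Data.Integer.Properties as ℤP
open import Data.Bool using (true; false; T; _∧_)
open import Data.Bool.Properties using (T-∧; T-irrelevant)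
open import Data.Unit using (tt)
open import Data.Empty using (⊥-elim)
open import Data.List using (List; []; _∷_; filter; map; upTo; cartesianProduct)
open import Data.List.Membership.Propositional using (_∈_)
open import Data.List.Membership.Propositional.Properties using (∈-cartesianProduct⁺; ∈-upTo⁺)
open import Data.List.Relation.Unary.Any using (here; there)
open import Data.Product using (Σ; Σ-syntax; _×_; _,_; proj₁; proj₂)
open import Data.Sum as Sum using (_⊎_; inj₁; inj₂)
open import Function using (_∘_; id)
open import Function.Bundles using (Equivalence)
open import Relation.Nullary using (yes; no)
open import Relation.Nullary.Decidable using (T?)
open import Relation.Binary.PropositionalEquality
open import Relation.Binary.Construct.Closure.ReflexiveTransitive using (Star; ε; _◅_; _◅◅_)

module Plays (G : Game) where
  open Game G

  module _ (σ : Strategy G P0) (τ : Strategy G P1) where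

    N : V → V
    N = next G σ τ

    π : V → ℕ → V
    π = play G σ τ

    play-suc : ∀ v m → π v (suc m) ≡ π (N v) m
    play-suc v zero    = refl
    play-suc v (suc m) = cong N (play-suc v m)

    play-+ : ∀ v k j → π v (k + j) ≡ π (π v k) j
    play-+ v k zero    = cong (π v) (+-identityʳ k)
    play-+ v k (suc j) = trans (cong (π v) (+-suc k j)) (cong N (play-+ v k j))

    step-edge : ∀ u → E u (N u)
    step-edge u with owner u in eq
    ... | P0 = proj₂ σ u eq
    ... | P1 = proj₂ τ u eq

    play-path : ∀ v m → Star E v (π v m)
    play-path v zero    = ε
    play-path v (suc m) = play-path v m ◅◅ (step-edge (π v m) ◅ ε)

    data ShortCycle (u : V) : Set where
      loop : N u ≡ u → ShortCycle u
      swap : N (N u) ≡ u → N u ≢ u → Ω (N u) ≤ Ω u → ShortCycle u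

    valuationAt : V → ℕ → Valuation G
    valuationAt v k = ⟨ π v k , filter (λ u → Ω (π v k) ℕ.<? Ω u) (map (π v) (upTo k)) , k ⟩

    module Ranking (μ : V → ℕ) where

      Descending : V → ℕ → Set
      Descending v k = ∀ i → i < k → μ (π v (suc i)) < μ (π v i)

      descend : (P : V → Set) → (∀ u → μ (N u) < μ u ⊎ P u) →
                ∀ v → Σ[ k ∈ ℕ ] (Descending v k × P (π v k))
      descend P step v = go (suc (μ v)) v ≤-refl
        where
        go : ∀ fuel v → μ v < fuel → Σ[ k ∈ ℕ ] (Descending v k × P (π v k))
        go (suc fuel) v μv<fuel with step v
        ... | inj₂ Pv = 0 , (λ _ ()) , Pv
        ... | inj₁ dec with go fuel (N v) (<-≤-trans dec (≤-pred μv<fuel))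
        ... | k , desc , P-end = suc k , desc′ , subst P (sym (play-suc v k)) P-end
          where
          desc′ : Descending v (suc k)
          desc′ zero    _           = dec
          desc′ (suc i) (s≤s i<k) =
            subst₂ (λ a b → μ a < μ b) (sym (play-suc v (suc i))) (sym (play-suc v i)) (desc i i<k)

      descending-< : ∀ {v k} → Descending v k → ∀ {i j} → i < j → j ≤ k → μ (π v j) < μ (π v i)
      descending-< desc {i} {suc j} i<1+j 1+j≤k with m≤n⇒m<n∨m≡n (≤-pred i<1+j)
      ... | inj₁ i<j  = <-trans (desc j 1+j≤k) (descending-< desc i<j (≤-trans (n≤1+n j) 1+j≤k))
      ... | inj₂ refl = desc i 1+j≤k

      descending-distinct : ∀ {v k} → Descending v k → ∀ {i j} → i < j → j ≤ k → π v i ≢ π v j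
      descending-distinct desc i<j j≤k eq = <-irrefl (cong μ (sym eq)) (descending-< desc i<j j≤k)

      valuationAt-isVal : ∀ {v k} → Descending v k → ShortCycle (π v k) → IsVal G σ τ v (valuationAt v k)
      valuationAt-isVal {v} {k} desc (loop cyc) = k , 1 , s≤s z≤n
        , (λ i j i<j j<k → descending-distinct desc i<j (<⇒≤ j<k))
        , (λ { _ zero () _ ; _ (suc _) _ (s≤s ()) })
        , (λ i i<k → descending-distinct desc i<k ≤-refl)
        , trans (play-+ v k 1) cyc
        , (λ { zero _ → ≤-reflexive (cong Ω (play-+ v k 0)) ; (suc _) (s≤s ()) })
        , refl , refl , refl
      valuationAt-isVal {v} {k} desc (swap cyc ne Ω≤) = k , 2 , s≤s z≤n
        , (λ i j i<j j<k → descending-distinct desc i<j (<⇒≤ j<k))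
        , on-cycle-distinct
        , (λ i i<k → descending-distinct desc i<k ≤-refl)
        , trans (play-+ v k 2) cyc
        , on-cycle-max
        , refl , refl , refl
        where
        on-cycle-distinct : ∀ i j → i < j → j < 2 → π v (k + i) ≢ π v (k + j)
        on-cycle-distinct zero (suc zero) _ _ eq =
          ne (trans (sym (play-+ v k 1)) (trans (sym eq) (play-+ v k 0)))
        on-cycle-distinct _ zero () _
        on-cycle-distinct (suc _) (suc zero) (s≤s ()) _
        on-cycle-distinct _ (suc (suc _)) _ (s≤s (s≤s ()))
        on-cycle-max : ∀ j → j < 2 → Ω (π v (k + j)) ≤ Ω (π v k)
        on-cycle-max zero _ = ≤-reflexive (cong Ω (play-+ v k 0))
        on-cycle-max (suc zero) _ = ≤-trans (≤-reflexive (cong Ω (play-+ v k 1))) Ω≤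
        on-cycle-max (suc (suc _)) (s≤s (s≤s ()))

      valuationBy : (P : V → Set) → (∀ u → μ (N u) < μ u ⊎ (ShortCycle u × P u)) →
                    ∀ v → Σ[ x ∈ Valuation G ] (IsVal G σ τ v x × P (Valuation.node x))
      valuationBy P step v with descend (λ u → ShortCycle u × P u) step v
      ... | k , desc , cyc , P-end = valuationAt v k , valuationAt-isVal desc cyc , P-end

      reachBy : (P : V → Set) → (∀ u → μ (N u) < μ u ⊎ P u) → ∀ v → Σ[ u ∈ V ] (Star E v u × P u)
      reachBy P step v with descend P step v
      ... | k , _ , P-end = π v k , play-path v k , P-end

  rewOf : Valuation G → ℤ
  rewOf x = rew G (Ω (Valuation.node x))

  ⪯⇒rew≤ : ∀ x y → _⪯_ G x y → rewOf x ℤ.≤ rewOf y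
  ⪯⇒rew≤ _ _ (inj₁ (inj₁ lt))       = ℤP.<⇒≤ lt
  ⪯⇒rew≤ _ _ (inj₁ (inj₂ (eq , _))) = ℤP.≤-reflexive eq
  ⪯⇒rew≤ x y (inj₂ (_ , y⊀x)) with rewOf x ℤ.≤? rewOf y
  ... | yes le = le
  ... | no ≰   = ⊥-elim (y⊀x (inj₁ (ℤP.≰⇒> ≰)))

  rew-between : ∀ {θ σ τθ τσ τ′ v x y z} →
    _,_⊴_,_ G θ τθ σ τσ → IsOptimalCounter G σ τσ →
    IsVal G θ τθ v x → IsVal G σ τσ v y → IsVal G σ τ′ v z →
    rewOf x ℤ.≤ rewOf y × rewOf y ℤ.≤ rewOf z
  rew-between {τ′ = τ′} {v} {x} {y} {z} θ⊴σ opt valx valy valz =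
    ⪯⇒rew≤ x y (θ⊴σ v x y valx valy) , ⪯⇒rew≤ y z (opt τ′ v y z valy valz)

  rew≡-1 : ∀ p → rew G p ≡ -1ℤ → p ≡ 1
  rew≡-1 p eq with p % 2 ≡ᵇ 0
  rew≡-1 p () | true
  ... | false = ℤP.+-injective (ℤP.neg-injective eq)

module GnFacts (n : ℕ) (3≤n : 3 ≤ n) where

  G : Game
  G = Gn n

  open Game G
  open Plays G

  bounds : ∀ a b c d → T ((a ≤ᵇ b) ∧ (c ≤ᵇ d)) → a ≤ b × c ≤ d
  bounds a b c d p with Equivalence.to T-∧ p
  ... | p₁ , p₂ = ≤ᵇ⇒≤ a b p₁ , ≤ᵇ⇒≤ c d p₂

  within : ∀ a b c d → a ≤ b → c ≤ d → T ((a ≤ᵇ b) ∧ (c ≤ᵇ d))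
  within _ _ _ _ a≤b c≤d = Equivalence.from T-∧ (≤⇒≤ᵇ a≤b , ≤⇒≤ᵇ c≤d)

  range₂ : ∀ {i} → T ((2 ≤ᵇ i) ∧ (i ≤ᵇ n)) → 2 ≤ i × i ≤ n
  range₂ {i} = bounds 2 i i n

  range-b : ∀ {i} → T ((2 ≤ᵇ i) ∧ (suc i ≤ᵇ n)) → 2 ≤ i × i < n
  range-b {i} = bounds 2 i (suc i) n

  range₁ : ∀ {i} → T ((1 ≤ᵇ i) ∧ (i ≤ᵇ n)) → 1 ≤ i × i ≤ n
  range₁ {i} = bounds 1 i i n

  in-range₂ : ∀ {i} → 2 ≤ i → i ≤ n → T ((2 ≤ᵇ i) ∧ (i ≤ᵇ n))
  in-range₂ {i} = within 2 i i n

  in-range-b : ∀ {i} → 2 ≤ i → i < n → T ((2 ≤ᵇ i) ∧ (suc i ≤ᵇ n))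
  in-range-b {i} = within 2 i (suc i) n

  in-range₁ : ∀ {i} → 1 ≤ i → i ≤ n → T ((1 ≤ᵇ i) ∧ (i ≤ᵇ n))
  in-range₁ {i} = within 1 i i n

  1≤n : 1 ≤ n
  1≤n = ≤-trans (s≤s z≤n) 3≤n

  2≤⇒1≤ : ∀ {i} → 2 ≤ i → 1 ≤ i
  2≤⇒1≤ = ≤-trans (n≤1+n 1)

  node-≡ : ∀ {r} {p q : T (valid n r)} → _≡_ {A = Node n} (r , p) (r , q)
  node-≡ {r} {p} {q} = cong (r ,_) (T-irrelevant p q)

  aN-cases : ∀ i → i ≤ n → aN n (suc i) ≡ (kT , 0) ⊎ (i < n × aN n (suc i) ≡ (kA , suc i))
  aN-cases i i≤n with i ≡ᵇ n in eq
  ... | true  = inj₁ refl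
  ... | false = inj₂ (≤∧≢⇒< i≤n (λ i≡n → subst T eq (≡⇒≡ᵇ i n i≡n)) , refl)

  aN-valid : ∀ {i} → 1 ≤ i → i ≤ n → T (valid n (aN n (suc i)))
  aN-valid {i} 1≤i i≤n with aN-cases i i≤n
  ... | inj₁ eq         rewrite eq = tt
  ... | inj₂ (i<n , eq) rewrite eq = in-range₂ (s≤s 1≤i) i<n

  edge-valid : ∀ {r r′} → T (valid n r) → REdge n r r′ → T (valid n r′)
  edge-valid p (a1 i) = in-range₁ {i} (2≤⇒1≤ (proj₁ (range₂ p))) (proj₂ (range₂ p))
  edge-valid p (a0 i) = aN-valid {i} (2≤⇒1≤ (proj₁ (range₂ p))) (proj₂ (range₂ p))
  edge-valid p (b1 i) = in-range₁ {i} (2≤⇒1≤ (proj₁ (range-b p))) (<⇒≤ (proj₂ (range-b p)))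
  edge-valid {kB , 2} p (b0 _) = in-range₁ ≤-refl 1≤n
  edge-valid {kB , suc (suc (suc _))} p (b0 _) = in-range-b (s≤s (s≤s z≤n)) (<⇒≤ (proj₂ (range-b p)))
  edge-valid p (c1 i) = in-range₁ {i} (2≤⇒1≤ (proj₁ (range₂ p))) (proj₂ (range₂ p))
  edge-valid {kC , 2} p (c0 _) = in-range₁ ≤-refl 1≤n
  edge-valid {kC , suc (suc (suc _))} p (c0 _) = in-range₂ (s≤s (s≤s z≤n)) (<⇒≤ (proj₂ (range₂ p)))
  edge-valid p (d1 i) = in-range₁ {i} (2≤⇒1≤ (proj₁ (range₂ p))) (proj₂ (range₂ p))
  edge-valid {kD , 2} p (d0 _) = in-range₁ ≤-refl 1≤n
  edge-valid {kD , suc (suc (suc _))} p (d0 _) = in-range-b (s≤s (s≤s z≤n)) (proj₂ (range₂ p))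
  edge-valid p (e1 _) = p
  edge-valid p (e0 _) = tt
  edge-valid p (Fh _) = p
  edge-valid p (Fe _) = p
  edge-valid p (Fd i 1<i) = in-range₂ 1<i (proj₂ (range₁ {i} p))
  edge-valid p (gF _) = p
  edge-valid p (hA i) = aN-valid {i} (proj₁ (range₁ p)) (proj₂ (range₁ p))
  edge-valid p sc = in-range₂ (≤-trans (n≤1+n 2) 3≤n) ≤-refl
  edge-valid p tT = tt

  Choice : Set
  Choice = (v : Node n) → Σ[ r ∈ Raw ] REdge n (proj₁ v) r

  strategyOf : Choice → (i : Player) → Strategy G i
  strategyOf c i = (λ v → proj₁ (c v) , edge-valid (proj₂ v) (proj₂ (c v))) , (λ v _ → proj₂ (c v))

  -- the moves of θ at player-0 nodes, and at player-1 nodes the moves towards t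
  canonical : Choice
  canonical ((kA , i) , _) = _ , a0 i
  canonical ((kB , i) , _) = _ , b0 i
  canonical ((kC , i) , _) = _ , c0 i
  canonical ((kD , i) , _) = _ , d1 i
  canonical ((kE , 1) , _) = _ , e1 1
  canonical ((kE , i) , _) = _ , e0 i
  canonical ((kF , i) , _) = _ , Fh i
  canonical ((kG , i) , _) = _ , gF i
  canonical ((kH , i) , _) = _ , hA i
  canonical ((kS , 0) , _) = _ , sc
  canonical ((kT , 0) , _) = _ , tT

  θ₀ : Strategy G P0
  θ₀ = strategyOf canonical P0

  has-successor : ∀ v → Σ[ w ∈ V ] E v w
  has-successor v = proj₁ θ₀ v , proj₂ (canonical v)

  θ₀-isTheta : IsTheta n θ₀
  θ₀-isTheta ((kA , i) , _) _ = θa i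
  θ₀-isTheta ((kB , i) , _) _ = θb i
  θ₀-isTheta ((kC , i) , _) _ = θc i
  θ₀-isTheta ((kD , i) , _) _ = θd i
  θ₀-isTheta ((kE , 1) , _) _ = θe1
  θ₀-isTheta ((kE , suc (suc i)) , _) _ = θe0 _ (s≤s (s≤s z≤n))

  τ-sink : Strategy G P1
  τ-sink = strategyOf canonical P1

  kinds : List Kind
  kinds = kA ∷ kB ∷ kC ∷ kD ∷ kE ∷ kF ∷ kG ∷ kH ∷ kS ∷ kT ∷ []

  ∈-kinds : ∀ k → k ∈ kinds
  ∈-kinds kA = here refl
  ∈-kinds kB = there (here refl)
  ∈-kinds kC = there (there (here refl))
  ∈-kinds kD = there (there (there (here refl)))
  ∈-kinds kE = there (there (there (there (here refl))))
  ∈-kinds kF = there (there (there (there (there (here refl)))))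
  ∈-kinds kG = there (there (there (there (there (there (here refl))))))
  ∈-kinds kH = there (there (there (there (there (there (there (here refl)))))))
  ∈-kinds kS = there (there (there (there (there (there (there (there (here refl))))))))
  ∈-kinds kT = there (there (there (there (there (there (there (there (there (here refl)))))))))

  index≤n : ∀ r → T (valid n r) → proj₂ r ≤ n
  index≤n (kA , i) p = proj₂ (range₂ p)
  index≤n (kB , i) p = <⇒≤ (proj₂ (range-b p))
  index≤n (kC , i) p = proj₂ (range₂ p)
  index≤n (kD , i) p = proj₂ (range₂ p)
  index≤n (kE , i) p = proj₂ (range₁ p)
  index≤n (kF , i) p = proj₂ (range₁ p)
  index≤n (kG , i) p = proj₂ (range₁ p)
  index≤n (kH , i) p = proj₂ (range₁ p)
  index≤n (kS , 0) p = z≤n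
  index≤n (kT , 0) p = z≤n

  nodesAmong : List Raw → List (Node n)
  nodesAmong [] = []
  nodesAmong (r ∷ rs) with T? (valid n r)
  ... | yes p = (r , p) ∷ nodesAmong rs
  ... | no _  = nodesAmong rs

  ∈-nodesAmong : ∀ {r rs} (p : T (valid n r)) → r ∈ rs → (r , p) ∈ nodesAmong rs
  ∈-nodesAmong {r} {r′ ∷ rs} p r∈ with T? (valid n r′) | r∈
  ... | yes _  | here refl = here node-≡
  ... | yes _  | there r∈rs = there (∈-nodesAmong p r∈rs)
  ... | no ¬p′ | here refl = ⊥-elim (¬p′ p)
  ... | no _   | there r∈rs = ∈-nodesAmong p r∈rs

  -- G_n is finite: all its nodes occur among the names with index at most n
  node-list : Σ[ xs ∈ List (Node n) ] (∀ v → v ∈ xs)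
  node-list = nodesAmong (cartesianProduct kinds (upTo (suc n))) ,
    λ { ((k , i) , p) → ∈-nodesAmong p (∈-cartesianProduct⁺ (∈-kinds k) (∈-upTo⁺ (s≤s (index≤n (k , i) p)))) }

  two-successors : ∀ (v : Node n) {r₁ r₂} (e₁ : REdge n (proj₁ v) r₁) (e₂ : REdge n (proj₁ v) r₂) →
    r₁ ≢ r₂ → (∀ {r} → REdge n (proj₁ v) r → r ≡ r₁ ⊎ r ≡ r₂) →
    Σ[ w₁ ∈ V ] Σ[ w₂ ∈ V ] (w₁ ≢ w₂ × E v w₁ × E v w₂ × (∀ w → E v w → w ≡ w₁ ⊎ w ≡ w₂))
  two-successors v e₁ e₂ r₁≢r₂ only =
    (_ , edge-valid (proj₂ v) e₁) , (_ , edge-valid (proj₂ v) e₂) ,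
    (λ w₁≡w₂ → r₁≢r₂ (cong proj₁ w₁≡w₂)) , e₁ , e₂ ,
    λ { (r , _) e → Sum.map (λ { refl → node-≡ }) (λ { refl → node-≡ }) (only e) }

  g-differs-from-aN : ∀ i → i ≤ n → (kG , i) ≢ aN n (suc i)
  g-differs-from-aN i i≤n with aN-cases i i≤n
  ... | inj₁ eq       rewrite eq = λ ()
  ... | inj₂ (_ , eq) rewrite eq = λ ()

  isBinary : IsBinary G
  isBinary v@((kA , i) , p) _ = two-successors v (a1 i) (a0 i) (g-differs-from-aN i (proj₂ (range₂ p)))
    λ { (a1 _) → inj₁ refl ; (a0 _) → inj₂ refl }
  isBinary v@((kB , 2) , _) _ = two-successors v (b1 _) (b0 _) (λ ()) λ { (b1 _) → inj₁ refl ; (b0 _) → inj₂ refl }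
  isBinary v@((kB , suc (suc (suc _))) , _) _ =
    two-successors v (b1 _) (b0 _) (λ ()) λ { (b1 _) → inj₁ refl ; (b0 _) → inj₂ refl }
  isBinary v@((kC , 2) , _) _ = two-successors v (c1 _) (c0 _) (λ ()) λ { (c1 _) → inj₁ refl ; (c0 _) → inj₂ refl }
  isBinary v@((kC , suc (suc (suc _))) , _) _ =
    two-successors v (c1 _) (c0 _) (λ ()) λ { (c1 _) → inj₁ refl ; (c0 _) → inj₂ refl }
  isBinary v@((kD , 2) , _) _ = two-successors v (d1 _) (d0 _) (λ ()) λ { (d1 _) → inj₁ refl ; (d0 _) → inj₂ refl }
  isBinary v@((kD , suc (suc (suc _))) , _) _ =
    two-successors v (d1 _) (d0 _) (λ ()) λ { (d1 _) → inj₁ refl ; (d0 _) → inj₂ refl }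
  isBinary v@((kE , i) , _) _ = two-successors v (e1 i) (e0 i) (λ ()) λ { (e1 _) → inj₁ refl ; (e0 _) → inj₂ refl }

  ∸-step : ∀ {i} → i < n → n ∸ i ≡ suc (n ∸ suc i)
  ∸-step i<n = +-∸-assoc 1 i<n

  -- A rank decreasing along every play against τ-sink, whatever player 0 does:
  -- e above d and s, these above the b's and c's (by index), below them the
  -- blocks a_i > g_i > F_i > h_i ordered by decreasing i, and t at the bottom.
  ψ : Raw → ℕ
  ψ (kT , _) = 0
  ψ (kA , i) = 4 + (n ∸ i) * 4
  ψ (kG , i) = 3 + (n ∸ i) * 4
  ψ (kF , i) = 2 + (n ∸ i) * 4
  ψ (kH , i) = 1 + (n ∸ i) * 4
  ψ (kB , j) = 4 + (n * 4 + j)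
  ψ (kC , j) = 4 + (n * 4 + j)
  ψ (kD , _) = 5 + (n * 4 + n)
  ψ (kS , _) = 5 + (n * 4 + n)
  ψ (kE , _) = 6 + (n * 4 + n)

  ψ-aN : ∀ i → i ≤ n → ψ (aN n (suc i)) < 1 + (n ∸ i) * 4
  ψ-aN i i≤n with aN-cases i i≤n
  ... | inj₁ eq         rewrite eq = s≤s z≤n
  ... | inj₂ (i<n , eq) rewrite eq | ∸-step i<n = ≤-refl

  block<bc : ∀ i j c → c ≤ 3 → c + (n ∸ i) * 4 < 4 + (n * 4 + j)
  block<bc i j c c≤3 = s≤s (+-mono-≤ c≤3 (≤-trans (*-monoˡ-≤ 4 (m∸n≤m n i)) (m≤m+n (n * 4) j)))

  ψ-player0 : ∀ {r r′} → T (valid n r) → ownerR (proj₁ r) ≡ P0 → REdge n r r′ → ψ r′ < ψ r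
  ψ-player0 p _ (a1 i) = ≤-refl
  ψ-player0 p _ (a0 i) = <-≤-trans (ψ-aN i (proj₂ (range₂ p))) (+-monoˡ-≤ ((n ∸ i) * 4) (s≤s z≤n))
  ψ-player0 p _ (b1 i) = block<bc i i 3 ≤-refl
  ψ-player0 {kB , 2} p _ (b0 _) = block<bc 1 2 3 ≤-refl
  ψ-player0 {kB , suc (suc (suc _))} p _ (b0 _) = +-monoʳ-< 4 (+-monoʳ-< (n * 4) ≤-refl)
  ψ-player0 p _ (c1 i) = block<bc i i 3 ≤-refl
  ψ-player0 {kC , 2} p _ (c0 _) = block<bc 1 2 3 ≤-refl
  ψ-player0 {kC , suc (suc (suc _))} p _ (c0 _) = +-monoʳ-< 4 (+-monoʳ-< (n * 4) ≤-refl)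
  ψ-player0 p _ (d1 i) = ≤-trans (block<bc i n 2 (n≤1+n 2)) (n≤1+n _)
  ψ-player0 {kD , 2} p _ (d0 _) = ≤-trans (block<bc 1 n 3 ≤-refl) (n≤1+n _)
  ψ-player0 {kD , suc (suc (suc j))} p _ (d0 _) =
    +-monoʳ-≤ 5 (+-monoʳ-≤ (n * 4) (≤-trans (n≤1+n _) (proj₂ (range₂ p))))
  ψ-player0 p _ (e1 i) = ≤-trans (block<bc i n 2 (n≤1+n 2)) (≤-trans (n≤1+n _) (n≤1+n _))
  ψ-player0 p _ (e0 i) = ≤-refl

  toSink-descends : ∀ σ (u : Node n) → ψ (proj₁ (N σ τ-sink u)) < ψ (proj₁ u) ⊎ u ≡ tNode n
  toSink-descends σ u@((kA , _) , p) = inj₁ (ψ-player0 p refl (proj₂ σ u refl))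
  toSink-descends σ u@((kB , _) , p) = inj₁ (ψ-player0 p refl (proj₂ σ u refl))
  toSink-descends σ u@((kC , _) , p) = inj₁ (ψ-player0 p refl (proj₂ σ u refl))
  toSink-descends σ u@((kD , _) , p) = inj₁ (ψ-player0 p refl (proj₂ σ u refl))
  toSink-descends σ u@((kE , _) , p) = inj₁ (ψ-player0 p refl (proj₂ σ u refl))
  toSink-descends σ ((kF , _) , _) = inj₁ ≤-refl
  toSink-descends σ ((kG , _) , _) = inj₁ ≤-refl
  toSink-descends σ ((kH , i) , p) = inj₁ (ψ-aN i (proj₂ (range₁ p)))
  toSink-descends σ ((kS , 0) , _) = inj₁ ≤-refl
  toSink-descends σ ((kT , 0) , _) = inj₂ refl

  reach-t : ∀ v → Star E v (tNode n)
  reach-t v with Ranking.reachBy θ₀ τ-sink (ψ ∘ proj₁) (_≡ tNode n) (toSink-descends θ₀) v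
  ... | _ , path , refl = path

  toSink-valuation : ∀ σ v → Σ[ z ∈ Valuation G ] (IsVal G σ τ-sink v z × Valuation.node z ≡ tNode n)
  toSink-valuation σ = Ranking.valuationBy σ τ-sink (ψ ∘ proj₁) (_≡ tNode n)
    λ u → Sum.map₂ (λ { refl → loop refl , refl }) (toSink-descends σ u)

  -- A rank decreasing along the plays of θ, whatever player 1 does, except on
  -- the 2-cycles F_1 ↔ e_1 and F_i ↔ d_i closed by θ.  It follows θ's descent
  -- e_i → s → c_n → … → c_2 → g_1 and b_j → … → g_1, then g_1 → F_1 → h_1 → a_2 → … → t;
  -- for i ≥ 2 the nodes g_i, d_i, F_i, e_i lie above s.
  μ : Raw → ℕ
  μ (kT , _) = 0
  μ (kA , i) = 1 + (n ∸ i)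
  μ (kH , _) = 1 + n
  μ (kF , 1) = 2 + n
  μ (kF , _) = 7 + (n + n)
  μ (kE , 1) = 3 + n
  μ (kE , _) = 6 + (n + n)
  μ (kG , 1) = 4 + n
  μ (kG , _) = 9 + (n + n)
  μ (kB , j) = 4 + (n + j)
  μ (kC , j) = 4 + (n + j)
  μ (kS , _) = 5 + (n + n)
  μ (kD , _) = 8 + (n + n)

  μ-aN : ∀ i → i ≤ n → μ (aN n (suc i)) < 1 + (n ∸ i)
  μ-aN i i≤n with aN-cases i i≤n
  ... | inj₁ eq         rewrite eq = s≤s z≤n
  ... | inj₂ (i<n , eq) rewrite eq | ∸-step i<n = ≤-refl

  μ-θ-edge : ∀ {r r′} → T (valid n r) → ThetaEdge n r r′ → μ r′ < μ r
  μ-θ-edge p (θa i) = μ-aN i (proj₂ (range₂ p))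
  μ-θ-edge {kB , 2} _ (θb _) = +-monoʳ-< 4 (m<m+n n (s≤s z≤n))
  μ-θ-edge {kB , suc (suc (suc _))} _ (θb _) = +-monoʳ-< 4 (+-monoʳ-< n ≤-refl)
  μ-θ-edge {kC , 2} _ (θc _) = +-monoʳ-< 4 (m<m+n n (s≤s z≤n))
  μ-θ-edge {kC , suc (suc (suc _))} _ (θc _) = +-monoʳ-< 4 (+-monoʳ-< n ≤-refl)
  μ-θ-edge {kD , suc (suc _)} _ (θd _) = ≤-refl
  μ-θ-edge _ θe1 = ≤-refl
  μ-θ-edge {kE , suc (suc _)} _ (θe0 _ _) = ≤-refl
  μ-θ-edge {kE , 1} _ (θe0 _ (s≤s ()))

  θ-at-e₁ : ∀ θ → IsTheta n θ → ∀ q (p : T (valid n (kF , 1))) → proj₁ θ ((kE , 1) , q) ≡ ((kF , 1) , p)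
  θ-at-e₁ θ isθ q p = target (proj₁ θ ((kE , 1) , q)) (isθ _ refl)
    where
    target : (w : Node n) → ThetaEdge n (kE , 1) (proj₁ w) → w ≡ ((kF , 1) , p)
    target (_ , _) θe1 = node-≡
    target (_ , _) (θe0 _ (s≤s ()))

  θ-at-d : ∀ θ → IsTheta n θ → ∀ {i} q (p : T (valid n (kF , i))) → proj₁ θ ((kD , i) , q) ≡ ((kF , i) , p)
  θ-at-d θ isθ {i} q p = target (proj₁ θ ((kD , i) , q)) (isθ _ refl)
    where
    target : (w : Node n) → ThetaEdge n (kD , i) (proj₁ w) → w ≡ ((kF , i) , p)
    target (_ , _) (θd _) = node-≡

  F-step : ∀ θ → IsTheta n θ → ∀ τ i p (w : Node n) → REdge n (kF , i) (proj₁ w) →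
    μ (proj₁ w) < μ (kF , i) ⊎ (N θ τ w ≡ ((kF , i) , p) × w ≢ ((kF , i) , p) × Ω w ≤ 6)
  F-step θ isθ τ 1 p (_ , _) (Fh _) = inj₁ ≤-refl
  F-step θ isθ τ (suc (suc _)) p (_ , _) (Fh _) = inj₁ (+-mono-≤ {2} {7} (s≤s (s≤s z≤n)) (m≤m+n n n))
  F-step θ isθ τ 1 p (_ , q) (Fe _) = inj₂ (θ-at-e₁ θ isθ q p , (λ ()) , n≤1+n 5)
  F-step θ isθ τ (suc (suc _)) p (_ , _) (Fe _) = inj₁ ≤-refl
  F-step θ isθ τ 1 p (_ , _) (Fd _ (s≤s ()))
  F-step θ isθ τ (suc (suc _)) p (_ , q) (Fd _ _) = inj₂ (θ-at-d θ isθ q p , (λ ()) , n≤1+n 5)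

  t-loop : ∀ (w : Node n) → REdge n (kT , 0) (proj₁ w) → w ≡ tNode n
  t-loop (_ , _) tT = node-≡

  -- Along a play of θ every step decreases μ or closes a short cycle, either
  -- the loop at t (reward -1) or a 2-cycle with top priority 6 at some F_i.
  θ-descends : ∀ θ → IsTheta n θ → ∀ τ (u : Node n) →
    μ (proj₁ (N θ τ u)) < μ (proj₁ u) ⊎ (ShortCycle θ τ u × -1ℤ ℤ.≤ rew G (Ω u))
  θ-descends θ isθ τ u@((kA , _) , p) = inj₁ (μ-θ-edge p (isθ u refl))
  θ-descends θ isθ τ u@((kB , _) , p) = inj₁ (μ-θ-edge p (isθ u refl))
  θ-descends θ isθ τ u@((kC , _) , p) = inj₁ (μ-θ-edge p (isθ u refl))
  θ-descends θ isθ τ u@((kD , _) , p) = inj₁ (μ-θ-edge p (isθ u refl))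
  θ-descends θ isθ τ u@((kE , _) , p) = inj₁ (μ-θ-edge p (isθ u refl))
  θ-descends θ isθ τ u@((kF , i) , p) with F-step θ isθ τ i p (proj₁ τ u) (proj₂ τ u refl)
  ... | inj₁ down              = inj₁ down
  ... | inj₂ (back , ne , Ω≤6) = inj₂ (swap back ne Ω≤6 , -≤+)
  θ-descends θ isθ τ u@((kG , 1) , _) with proj₁ τ u | proj₂ τ u refl
  ... | _ | gF _ = inj₁ (n≤1+n _)
  θ-descends θ isθ τ u@((kG , suc (suc _)) , _) with proj₁ τ u | proj₂ τ u refl
  ... | _ | gF _ = inj₁ (n≤1+n _)
  θ-descends θ isθ τ u@((kH , i) , p) with proj₁ τ u | proj₂ τ u refl
  ... | _ | hA _ = inj₁ (<-≤-trans (μ-aN i (proj₂ (range₁ p))) (s≤s (m∸n≤m n i)))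
  θ-descends θ isθ τ u@((kS , 0) , _) with proj₁ τ u | proj₂ τ u refl
  ... | _ | sc = inj₁ ≤-refl
  θ-descends θ isθ τ u@((kT , 0) , _) = inj₂ (loop (t-loop (proj₁ τ u) (proj₂ τ u refl)) , ℤP.≤-refl)

  t-or-above-1 : ∀ v → v ≡ tNode n ⊎ 1 < Ω v
  t-or-above-1 ((kA , _) , _) = inj₂ (s≤s (s≤s z≤n))
  t-or-above-1 ((kB , _) , _) = inj₂ (s≤s (s≤s z≤n))
  t-or-above-1 ((kC , _) , _) = inj₂ (s≤s (s≤s z≤n))
  t-or-above-1 ((kD , _) , _) = inj₂ (s≤s (s≤s z≤n))
  t-or-above-1 ((kE , _) , _) = inj₂ (s≤s (s≤s z≤n))
  t-or-above-1 ((kF , _) , _) = inj₂ (s≤s (s≤s z≤n))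
  t-or-above-1 ((kG , i) , _) = inj₂ (≤-trans (s≤s (s≤s z≤n)) (m≤n+m 7 (2 * i)))
  t-or-above-1 ((kH , i) , _) = inj₂ (≤-trans (s≤s (s≤s z≤n)) (m≤n+m 8 (2 * i)))
  t-or-above-1 ((kS , 0) , _) = inj₂ (s≤s (s≤s z≤n))
  t-or-above-1 ((kT , 0) , _) = inj₁ refl

  priority-1-is-t : ∀ v → Ω v ≡ 1 → v ≡ tNode n
  priority-1-is-t v Ωv≡1 = Sum.[ id , (λ 1<Ωv → ⊥-elim (<-irrefl (sym Ωv≡1) 1<Ωv)) ]′ (t-or-above-1 v)

  -- Condition (2) of sink games: the reward of Ξ_σ(w) is at least -1, since every
  -- valuation of θ is, and at most -1, the reward of σ against τ-sink; so its
  -- cycle node has priority 1 and is t.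
  cycles-end-in-t : ∀ θ → IsTheta n θ → ∀ (σ : Strategy G P0) (τθ τσ : Strategy G P1) →
    IsOptimalCounter G σ τσ → _,_⊴_,_ G θ τθ σ τσ →
    ∀ w y → IsVal G σ τσ w y → Valuation.node y ≡ tNode n
  cycles-end-in-t θ isθ σ τθ τσ optσ θ⊴σ w y valy
    with Ranking.valuationBy θ τθ (μ ∘ proj₁) _ (θ-descends θ isθ τθ) w | toSink-valuation σ w
  ... | x , valx , -1≤x | z , valz , z≡t with rew-between θ⊴σ optσ valx valy valz
  ... | x≤y , y≤z = priority-1-is-t (Valuation.node y) (rew≡-1 _ (ℤP.≤-antisym y≤-1 (ℤP.≤-trans -1≤x x≤y)))
    where
    y≤-1 : rewOf y ℤ.≤ -1ℤ
    y≤-1 = ℤP.≤-trans y≤z (ℤP.≤-reflexive (cong (λ u → rew G (Ω u)) z≡t))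

  -- G_n with θ is a sink game with sink t
  isSink : ∀ θ → IsTheta n θ → IsSinkGame G θ (tNode n)
  isSink θ isθ = (tT , refl , reach-t , above-t) ,
    λ σ τθ τσ _ optσ θ⊴σ → cycles-end-in-t θ isθ σ τθ τσ optσ θ⊴σ
    where
    above-t : ∀ w → w ≢ tNode n → 1 < Ω w
    above-t w w≢t = Sum.[ (λ w≡t → ⊥-elim (w≢t w≡t)) , id ]′ (t-or-above-1 w)

mainTheorem1 : (n : ℕ) → 3 ≤ n →
    IsParityGame (Gn n) × IsBinary (Gn n) × Σ (Strategy (Gn n) P0) (IsTheta n)
    × ((θ : Strategy (Gn n) P0) → IsTheta n θ → IsSinkGame (Gn n) θ (tNode n))
mainTheorem1 n 3≤n = (node-list , has-successor) , isBinary , (θ₀ , θ₀-isTheta) , isSink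
  where open GnFacts n 3≤n
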